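{- Let ${\cal A}$ be a finite Sidon set of integers with $k=|{\cal A}|$, and let $T$ be a positive integer. For each integer $i$ let $A_i := |{\cal A}\cap[i-T,i)|$. Define $$S({\cal A},T) := \sum_{\substack{1\le r\le T-1\\ r\notin {\cal A}-{\cal A}}} (T-r), \qquad V({\cal A},T) := \sum_{i=\min{\cal A}+1}^{T+\max{\cal A}} \left(A_i - \frac{kT}{T+\max{\cal A}-\min{\cal A}}\right)^2.$$ Then $$\operatorname{diam}({\cal A}) = \frac{k^2 T^2}{T(T+k-1) - \big(2S({\cal A},T)+V({\cal A},T)\big)} - T.$$
   Context: A Sidon set is a set ${\cal A}$ of integers such that the only solutions of $a_1+a_2=a_3+a_4$ with $a_i\in{\cal A}$ are the trivial ones with $\{a_1,a_2\}=\{a_3,a_4\}$. For a finite set ${\cal A}$, $\operatorname{diam}({\cal A}) := \max{\cal A}-\min{\cal A}$, and ${\cal A}-{\cal A}=\{a-b: a,b\in{\cal A}\}$ is its difference set. $[i-T,i)$ denotes the set of integers $j$ with $i-T\le j<i$. -}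

module Defs where

open import Data.Nat as ℕ using (ℕ; zero; suc)
open import Data.Integer as ℤ using (ℤ; +_)
open import Data.Rational as ℚ using (ℚ)
open import Data.List as L using (List; []; _∷_; length; map; upTo; filter; concatMap)
open import Data.List.NonEmpty as L⁺ using (List⁺; _∷_; toList)
open import Data.List.Membership.Propositional using (_∈_)
open import Data.List.Membership.DecPropositional ℤ._≟_ using (_∈?_)
open import Data.Product using (_×_; Σ-syntax)
open import Data.Sum using (_⊎_)
open import Relation.Binary.PropositionalEquality using (_≡_)
open import Relation.Nullary.Decidable using (_×-dec_; does)
open import Data.Bool using (if_then_else_)

IsSidon : List ℤ → Set
IsSidon A = ∀ {a₁ a₂ a₃ a₄} → a₁ ∈ A → a₂ ∈ A → a₃ ∈ A → a₄ ∈ A →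
  a₁ ℤ.+ a₂ ≡ a₃ ℤ.+ a₄ → (a₁ ≡ a₃ × a₂ ≡ a₄) ⊎ (a₁ ≡ a₄ × a₂ ≡ a₃)

minA : List⁺ ℤ → ℤ
minA (a ∷ as) = L.foldr ℤ._⊓_ a as

maxA : List⁺ ℤ → ℤ
maxA (a ∷ as) = L.foldr ℤ._⊔_ a as

diam : List⁺ ℤ → ℤ
diam A = maxA A ℤ.- minA A

diffs : List ℤ → List ℤ
diffs A = concatMap (λ a → map (λ b → a ℤ.- b) A) A

sumℚ : List ℚ → ℚ
sumℚ = L.foldr ℚ._+_ ℚ.0ℚ

S : List ℤ → ℕ → ℚ
S A T = sumℚ (map term (upTo T))
  where
  term : ℕ → ℚ
  term r = if r ℕ.≡ᵇ 0 then ℚ.0ℚ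
           else (if does ((+ r) ∈? diffs A) then ℚ.0ℚ
                 else ℚ._/_ (+ T ℤ.- + r) 1)

count : List ℤ → ℕ → ℤ → ℕ
count A T i = length (filter (λ a → (i ℤ.- + T) ℤ.≤? a ×-dec a ℤ.<? i) A)

-- division by a natural number (only used with a nonzero denominator)
_/'_ : ℤ → ℕ → ℚ
p /' zero = ℚ.0ℚ
p /' suc n = ℚ._/_ p (suc n)

V : List⁺ ℤ → ℕ → ℚ
V A T = sumℚ (map term (upTo n))
  where
  k = length (toList A)
  n = T ℕ.+ ℤ.∣ diam A ∣
  mean = (+ (k ℕ.* T)) /' n
  term : ℕ → ℚ
  term j = let d = ℚ._-_ (ℚ._/_ (+ count (toList A) T (minA A ℤ.+ + 1 ℤ.+ + j)) 1) mean
           in d ℚ.* d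

{-# OPTIONS --safe #-}
module Submission where

-- Index the windows [i - T, i), min A < i ≤ T + max A, by j < N := T + diam A.
-- Every element of A lies in exactly T windows, so ∑ A_i = kT, and two
-- elements a, b lie together in exactly T ∸ |a - b| windows, so
-- ∑ A_i² = ∑_{a,b} (T ∸ |a - b|). In a Sidon set a nonzero difference has at
-- most one representation, so for 0 < r < T there are 2·[r ∈ A - A] pairs at
-- distance r, and ∑ A_i² + 2S = kT + T(T - 1). Expanding the squares in V gives
-- V = ∑ A_i² - (kT)²/N, hence T(T + k - 1) - (2S + V) = (kT)²/N, while
-- N - T = diam A.

open import Algebra.Bundles using (CommutativeSemiring; CommutativeRing)
open import Data.Bool.Base using (true; false; if_then_else_)
open import Data.Empty using (⊥-elim)
open import Data.Integer.Base as ℤ using (ℤ; +_; +[1+_]; -[1+_]; _-_; _⊖_; ∣_∣)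
import Data.Integer.Properties as ℤ
import Data.Integer.Tactic.RingSolver as ℤ-Ring
open import Data.List.Base using (List; []; _∷_; map; foldr; upTo; length; filter)
open import Data.List.Membership.DecPropositional ℤ._≟_ using (_∈?_)
open import Data.List.Membership.Propositional using (_∈_; find)
open import Data.List.Membership.Propositional.Properties using (∈-concatMap⁺; ∈-concatMap⁻; ∈-upTo⁻)
open import Data.List.NonEmpty.Base using (List⁺; _∷_; toList)
open import Data.List.Properties using (map-∘; map-upTo; length-upTo)
import Data.List.Relation.Unary.All as All
open import Data.List.Relation.Unary.AllPairs using (_∷_)
open import Data.List.Relation.Unary.Any as Any using (Any; here; there; any?)
import Data.List.Relation.Unary.Any.Properties as Any
open import Data.List.Relation.Unary.Unique.Propositional using (Unique)
open import Data.Nat.Base as ℕ using (ℕ; zero; suc)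
import Data.Nat.Coprimality as Coprime
import Data.Nat.Properties as ℕ
open import Data.Nat.Tactic.RingSolver using (solve-∀)
open import Data.Product.Base as Product using (_×_; _,_; proj₁; proj₂; Σ-syntax)
open import Data.Product.Function.NonDependent.Propositional using (_×-⇔_)
open import Data.Rational.Base as ℚ using (ℚ; mkℚ)
import Data.Rational.Properties as ℚ
import Data.Rational.Unnormalised.Base as ℚᵘ
import Data.Rational.Unnormalised.Properties as ℚᵘ
open import Data.Sum.Base using (inj₁; inj₂)
open import Function.Base using (_∘_)
open import Function.Bundles using (_⇔_; mk⇔)
import Function.Properties.Equivalence as ⇔
open import Level using (0ℓ)
import Relation.Binary.PropositionalEquality as ≡
open import Relation.Nullary.Decidable using (Dec; yes; no; does; _×-dec_; dec-true; dec-false; does-⇔; dec⇒maybe)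
open import Relation.Nullary.Negation using (¬_)
import Tactic.RingSolver as RingSolver
open import Tactic.RingSolver.Core.AlmostCommutativeRing using (AlmostCommutativeRing; fromCommutativeRing)

open import Defs

-- Finite sums

module FiniteSum {c ℓ} (R : CommutativeSemiring c ℓ) where

  open CommutativeSemiring R
  open import Algebra.Properties.CommutativeSemigroup +-commutativeSemigroup using (interchange)

  ∑ : ∀ {a} {A : Set a} → List A → (A → Carrier) → Carrier
  ∑ xs f = foldr _+_ 0# (map f xs)

  infixl 10 ∑
  syntax ∑ xs (λ x → e) = ∑[ x ∈ xs ] e

  module _ {a} {A : Set a} where

    ∑-cong : ∀ (xs : List A) {f g : A → Carrier} → (∀ {x} → x ∈ xs → f x ≈ g x) → ∑ xs f ≈ ∑ xs g
    ∑-cong []       f≈g = refl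
    ∑-cong (x ∷ xs) f≈g = +-cong (f≈g (here ≡.refl)) (∑-cong xs (f≈g ∘ there))

    ∑-zero : ∀ (xs : List A) → ∑[ x ∈ xs ] 0# ≈ 0#
    ∑-zero []       = refl
    ∑-zero (x ∷ xs) = trans (+-identityˡ _) (∑-zero xs)

    ∑-distrib-+ : ∀ (xs : List A) (f g : A → Carrier) → ∑[ x ∈ xs ] (f x + g x) ≈ ∑ xs f + ∑ xs g
    ∑-distrib-+ []       f g = sym (+-identityˡ 0#)
    ∑-distrib-+ (x ∷ xs) f g =
      trans (+-cong refl (∑-distrib-+ xs f g)) (interchange (f x) (g x) (∑ xs f) (∑ xs g))

    *-distribˡ-∑ : ∀ y (xs : List A) (f : A → Carrier) → y * ∑ xs f ≈ ∑[ x ∈ xs ] (y * f x)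
    *-distribˡ-∑ y []       f = zeroʳ y
    *-distribˡ-∑ y (x ∷ xs) f = trans (distribˡ y (f x) (∑ xs f)) (+-cong refl (*-distribˡ-∑ y xs f))

    *-distribʳ-∑ : ∀ y (xs : List A) (f : A → Carrier) → ∑ xs f * y ≈ ∑[ x ∈ xs ] (f x * y)
    *-distribʳ-∑ y []       f = zeroˡ y
    *-distribʳ-∑ y (x ∷ xs) f = trans (distribʳ y (f x) (∑ xs f)) (+-cong refl (*-distribʳ-∑ y xs f))

  module _ {a b} {A : Set a} {B : Set b} (xs : List A) (ys : List B) where

    ∑-*-∑ : ∀ (f : A → Carrier) (g : B → Carrier) → ∑ xs f * ∑ ys g ≈ ∑[ x ∈ xs ] ∑[ y ∈ ys ] (f x * g y)
    ∑-*-∑ f g = trans (*-distribʳ-∑ (∑ ys g) xs f) (∑-cong xs (λ {x} _ → *-distribˡ-∑ (f x) ys g))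

    ∑-comm : ∀ (f : A → B → Carrier) → ∑[ x ∈ xs ] ∑[ y ∈ ys ] f x y ≈ ∑[ y ∈ ys ] ∑[ x ∈ xs ] f x y
    ∑-comm f = go xs
      where
      go : ∀ xs → ∑[ x ∈ xs ] ∑[ y ∈ ys ] f x y ≈ ∑[ y ∈ ys ] ∑[ x ∈ xs ] f x y
      go []       = sym (∑-zero ys)
      go (x ∷ xs) = trans (+-cong refl (go xs)) (sym (∑-distrib-+ ys (f x) (λ y → ∑[ x ∈ xs ] f x y)))

  ∑-upTo-suc : ∀ n (f : ℕ → Carrier) → ∑ (upTo (suc n)) f ≡.≡ f 0 + ∑ (upTo n) (f ∘ suc)
  ∑-upTo-suc n f = ≡.cong (λ xs → f 0 + foldr _+_ 0# xs)
    (≡.trans (≡.cong (map f) (≡.sym (map-upTo suc n))) (≡.sym (map-∘ (upTo n))))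

open FiniteSum ℕ.+-*-commutativeSemiring
open ≡ using (_≡_; _≢_; refl; cong; cong₂; sym; trans)
open ≡.≡-Reasoning
open import Data.Nat.Base using (z≤n; s≤s; _≤_; _<_; _+_; _*_; _∸_)

𝟙 : ∀ {p} {P : Set p} → Dec P → ℕ
𝟙 P? = if does P? then 1 else 0

module _ {p q} {P : Set p} {Q : Set q} where

  𝟙-cong : P ⇔ Q → (P? : Dec P) (Q? : Dec Q) → 𝟙 P? ≡ 𝟙 Q?
  𝟙-cong P⇔Q P? Q? = cong (λ b → if b then 1 else 0) (does-⇔ P⇔Q P? Q?)

  𝟙-× : (P? : Dec P) (Q? : Dec Q) → 𝟙 (P? ×-dec Q?) ≡ 𝟙 P? * 𝟙 Q?
  𝟙-× P? Q? with does P? | does Q?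
  ... | true  | true  = refl
  ... | true  | false = refl
  ... | false | _     = refl

module _ {p} {P : Set p} where

  𝟙-yes : P → (P? : Dec P) → 𝟙 P? ≡ 1
  𝟙-yes p P? = cong (λ b → if b then 1 else 0) (dec-true P? p)

  𝟙-no : ¬ P → (P? : Dec P) → 𝟙 P? ≡ 0
  𝟙-no ¬p P? = cong (λ b → if b then 1 else 0) (dec-false P? ¬p)

∑-const : ∀ {a} {A : Set a} (xs : List A) c → ∑[ x ∈ xs ] c ≡ length xs * c
∑-const []       c = refl
∑-const (x ∷ xs) c = cong (λ s → c + s) (∑-const xs c)

module _ {a p} {A : Set a} {P : A → Set p} (P? : ∀ x → Dec (P x)) where

  length-filter≡∑𝟙 : ∀ xs → length (filter P? xs) ≡ ∑[ x ∈ xs ] 𝟙 (P? x)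
  length-filter≡∑𝟙 []       = refl
  length-filter≡∑𝟙 (x ∷ xs) with does (P? x)
  ... | true  = cong suc (length-filter≡∑𝟙 xs)
  ... | false = length-filter≡∑𝟙 xs

  ∑-𝟙-atMostOne : ∀ {xs} → Unique xs → (∀ {x y} → x ∈ xs → y ∈ xs → P x → P y → x ≡ y) →
                  ∑[ x ∈ xs ] 𝟙 (P? x) ≡ 𝟙 (any? P? xs)
  ∑-𝟙-atMostOne {[]}     _              _   = refl
  -- Abstracting P? x also unfolds the indicator of any? P? (x ∷ xs) on the right.
  ∑-𝟙-atMostOne {x ∷ xs} (x∉xs ∷ unique) one with P? x
  ... | yes px = cong suc (trans (∑-cong xs (λ y∈xs → 𝟙-no (¬P y∈xs) (P? _))) (∑-zero xs))
    where
    ¬P : ∀ {y} → y ∈ xs → ¬ P y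
    ¬P y∈xs py = All.lookup x∉xs y∈xs (one (here refl) (there y∈xs) px py)
  ... | no _   = ∑-𝟙-atMostOne unique (λ x∈xs y∈xs → one (there x∈xs) (there y∈xs))

-- After peeling off j = 0, the indicators at j = 0, and at every j when hi = 0, compute to constants.
∑-interval : ∀ n lo hi → hi ≤ n → ∑[ j ∈ upTo n ] 𝟙 (j ℕ.<? hi ×-dec lo ℕ.≤? j) ≡ hi ∸ lo
∑-interval zero    lo       zero     z≤n        = sym (ℕ.0∸n≡0 lo)
∑-interval (suc n) lo       zero     _          =
  trans (∑-upTo-suc n (λ j → 𝟙 (j ℕ.<? 0 ×-dec lo ℕ.≤? j))) (trans (∑-zero (upTo n)) (sym (ℕ.0∸n≡0 lo)))
∑-interval (suc n) zero     (suc hi) (s≤s hi≤n) =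
  trans (∑-upTo-suc n (λ j → 𝟙 (j ℕ.<? suc hi ×-dec 0 ℕ.≤? j))) (cong suc (∑-interval n zero hi hi≤n))
∑-interval (suc n) (suc lo) (suc hi) (s≤s hi≤n) = begin
  ∑[ j ∈ upTo (suc n) ] 𝟙 (j ℕ.<? suc hi ×-dec suc lo ℕ.≤? j)
    ≡⟨ ∑-upTo-suc n (λ j → 𝟙 (j ℕ.<? suc hi ×-dec suc lo ℕ.≤? j)) ⟩
  ∑[ j ∈ upTo n ] 𝟙 (suc j ℕ.<? suc hi ×-dec suc lo ℕ.≤? suc j)
    ≡⟨ ∑-cong (upTo n) (λ {j} _ → 𝟙-cong shift (suc j ℕ.<? suc hi ×-dec suc lo ℕ.≤? suc j) (j ℕ.<? hi ×-dec lo ℕ.≤? j)) ⟩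
  ∑[ j ∈ upTo n ] 𝟙 (j ℕ.<? hi ×-dec lo ℕ.≤? j)
    ≡⟨ ∑-interval n lo hi hi≤n ⟩
  hi ∸ lo ∎
  where
  shift : ∀ {j} → (suc j < suc hi × suc lo ≤ suc j) ⇔ (j < hi × lo ≤ j)
  shift = mk⇔ (Product.map ℕ.s≤s⁻¹ ℕ.s≤s⁻¹) (Product.map s≤s s≤s)

∑-select : ∀ n (f : ℕ → ℕ) → (∀ x → n ≤ x → f x ≡ 0) → ∀ x → ∑[ r ∈ upTo n ] (𝟙 (x ℕ.≟ r) * f r) ≡ f x
∑-select zero    f vanish x       = sym (vanish x z≤n)
∑-select (suc n) f vanish zero    = trans (∑-upTo-suc n (λ r → 𝟙 (0 ℕ.≟ r) * f r))
  (trans (cong₂ _+_ (ℕ.*-identityˡ (f 0)) (∑-zero (upTo n))) (ℕ.+-identityʳ (f 0)))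
∑-select (suc n) f vanish (suc x) = trans (∑-upTo-suc n (λ r → 𝟙 (suc x ℕ.≟ r) * f r))
  (∑-select n (f ∘ suc) (λ y n≤y → vanish (suc y) (s≤s n≤y)) x)

∑-fibres : ∀ n (f : ℕ → ℕ) → (∀ x → n ≤ x → f x ≡ 0) → ∀ {a} {A : Set a} (xs : List A) (g : A → ℕ) →
           ∑[ x ∈ xs ] f (g x) ≡ ∑[ r ∈ upTo n ] (∑[ x ∈ xs ] 𝟙 (g x ℕ.≟ r) * f r)
∑-fibres n f vanish xs g = begin
  ∑[ x ∈ xs ] f (g x)                               ≡⟨ ∑-cong xs (λ _ → sym (∑-select n f vanish (g _))) ⟩
  ∑[ x ∈ xs ] ∑[ r ∈ upTo n ] (𝟙 (g x ℕ.≟ r) * f r)  ≡⟨ ∑-comm xs (upTo n) _ ⟩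
  ∑[ r ∈ upTo n ] ∑[ x ∈ xs ] (𝟙 (g x ℕ.≟ r) * f r)  ≡⟨ ∑-cong (upTo n) (λ {r} _ → sym (*-distribʳ-∑ (f r) xs _)) ⟩
  ∑[ r ∈ upTo n ] (∑[ x ∈ xs ] 𝟙 (g x ℕ.≟ r) * f r)  ∎

2*∑-upTo-∸ : ∀ t → 2 * ∑[ r ∈ upTo t ] (t ∸ r) ≡ t * suc t
2*∑-upTo-∸ zero    = refl
2*∑-upTo-∸ (suc t) = begin
  2 * ∑[ r ∈ upTo (suc t) ] (suc t ∸ r)    ≡⟨ cong (2 *_) (∑-upTo-suc t (suc t ∸_)) ⟩
  2 * (suc t + ∑[ r ∈ upTo t ] (t ∸ r))    ≡⟨ ℕ.*-distribˡ-+ 2 (suc t) _ ⟩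
  2 * suc t + 2 * ∑[ r ∈ upTo t ] (t ∸ r)  ≡⟨ cong (λ s → 2 * suc t + s) (2*∑-upTo-∸ t) ⟩
  2 * suc t + t * suc t                    ≡⟨ arithmetic t ⟩
  suc t * suc (suc t)                      ∎
  where
  arithmetic : ∀ t → 2 * suc t + t * suc t ≡ suc t * suc (suc t)
  arithmetic = solve-∀

-- Windows

InWindow : ℕ → ℕ → ℕ → Set
InWindow T x j = j < x + T × x ≤ j

inWindow? : ∀ T x j → Dec (InWindow T x j)
inWindow? T x j = j ℕ.<? x + T ×-dec x ℕ.≤? j

module _ {T n : ℕ} where

  ∑-window : ∀ {x} → x + T ≤ n → ∑[ j ∈ upTo n ] 𝟙 (inWindow? T x j) ≡ T
  ∑-window {x} x+T≤n = trans (∑-interval n x (x + T) x+T≤n) (ℕ.m+n∸m≡n x T)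

  private
    ∑-window-overlap-≤ : ∀ {x y} → x ≤ y → x + T ≤ n →
      ∑[ j ∈ upTo n ] (𝟙 (inWindow? T x j) * 𝟙 (inWindow? T y j)) ≡ T ∸ ∣ x ⊖ y ∣
    ∑-window-overlap-≤ {x} {y} x≤y x+T≤n = begin
      ∑[ j ∈ upTo n ] (𝟙 (inWindow? T x j) * 𝟙 (inWindow? T y j))
        ≡⟨ ∑-cong (upTo n) (λ {j} _ → trans (sym (𝟙-× (inWindow? T x j) (inWindow? T y j)))
                                            (𝟙-cong intersection (inWindow? T x j ×-dec inWindow? T y j)
                                                                 (j ℕ.<? x + T ×-dec y ℕ.≤? j))) ⟩
      ∑[ j ∈ upTo n ] 𝟙 (j ℕ.<? x + T ×-dec y ℕ.≤? j) ≡⟨ ∑-interval n y (x + T) x+T≤n ⟩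
      (x + T) ∸ y                                    ≡⟨ cong ((x + T) ∸_) (sym (ℕ.m+[n∸m]≡n x≤y)) ⟩
      (x + T) ∸ (x + (y ∸ x))                        ≡⟨ ℕ.[m+n]∸[m+o]≡n∸o x T (y ∸ x) ⟩
      T ∸ (y ∸ x)                                    ≡⟨ cong (T ∸_) (sym (ℤ.∣⊖∣-≤ x≤y)) ⟩
      T ∸ ∣ x ⊖ y ∣                                  ∎
      where
      intersection : ∀ {j} → (InWindow T x j × InWindow T y j) ⇔ (j < x + T × y ≤ j)
      intersection = mk⇔ (λ ((j<x+T , _) , (_ , y≤j)) → j<x+T , y≤j)
        (λ (j<x+T , y≤j) → (j<x+T , ℕ.≤-trans x≤y y≤j) , (ℕ.<-≤-trans j<x+T (ℕ.+-monoˡ-≤ T x≤y) , y≤j))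

  ∑-window-overlap : ∀ {x y} → x + T ≤ n → y + T ≤ n →
    ∑[ j ∈ upTo n ] (𝟙 (inWindow? T x j) * 𝟙 (inWindow? T y j)) ≡ T ∸ ∣ x ⊖ y ∣
  ∑-window-overlap {x} {y} x+T≤n y+T≤n with ℕ.≤-total x y
  ... | inj₁ x≤y = ∑-window-overlap-≤ x≤y x+T≤n
  ... | inj₂ y≤x = begin
    ∑[ j ∈ upTo n ] (𝟙 (inWindow? T x j) * 𝟙 (inWindow? T y j)) ≡⟨ ∑-cong (upTo n) (λ {j} _ → ℕ.*-comm (𝟙 (inWindow? T x j)) _) ⟩
    ∑[ j ∈ upTo n ] (𝟙 (inWindow? T y j) * 𝟙 (inWindow? T x j)) ≡⟨ ∑-window-overlap-≤ y≤x y+T≤n ⟩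
    T ∸ ∣ y ⊖ x ∣                                             ≡⟨ cong (T ∸_) (ℤ.∣m⊖n∣≡∣n⊖m∣ y x) ⟩
    T ∸ ∣ x ⊖ y ∣                                             ∎

module _ (c : ℤ) where

  private
    -c+[c+i]≡i : ∀ i → ℤ.- c ℤ.+ (c ℤ.+ i) ≡ i
    -c+[c+i]≡i i = solve c i
      where
      solve : ∀ c i → ℤ.- c ℤ.+ (c ℤ.+ i) ≡ i
      solve = ℤ-Ring.solve-∀

  translate-≤ : ∀ {u v p q} → u ≡ c ℤ.+ + p → v ≡ c ℤ.+ + q → (u ℤ.≤ v) ⇔ (p ≤ q)
  translate-≤ refl refl = mk⇔
    (ℤ.drop‿+≤+ ∘ ≡.subst₂ ℤ._≤_ (-c+[c+i]≡i _) (-c+[c+i]≡i _) ∘ ℤ.+-monoʳ-≤ (ℤ.- c))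
    (ℤ.+-monoʳ-≤ c ∘ ℤ.+≤+)

  translate-< : ∀ {u v p q} → u ≡ c ℤ.+ + p → v ≡ c ℤ.+ + q → (u ℤ.< v) ⇔ (p < q)
  translate-< refl refl = mk⇔
    (ℤ.drop‿+<+ ∘ ≡.subst₂ ℤ._<_ (-c+[c+i]≡i _) (-c+[c+i]≡i _) ∘ ℤ.+-monoʳ-< (ℤ.- c))
    (ℤ.+-monoʳ-< c ∘ ℤ.+<+)

window⇔ : ∀ {m a x} j T → a ≡ m ℤ.+ + x →
          ((m ℤ.+ + 1 ℤ.+ + j) - + T ℤ.≤ a × a ℤ.< m ℤ.+ + 1 ℤ.+ + j) ⇔ InWindow T x j
window⇔ {m} {a} {x} j T refl =
  translate-≤ (m - + T) (shift₁ m (+ j) (+ T)) (shift₂ m (+ x) (+ T))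
  ×-⇔ ⇔.trans (translate-< m refl (ℤ.+-assoc m (+ 1) (+ j))) (mk⇔ ℕ.s≤s⁻¹ s≤s)
  where
  shift₁ : ∀ m j t → (m ℤ.+ + 1 ℤ.+ j) - t ≡ (m - t) ℤ.+ (+ 1 ℤ.+ j)
  shift₁ = ℤ-Ring.solve-∀
  shift₂ : ∀ m x t → m ℤ.+ x ≡ (m - t) ℤ.+ (x ℤ.+ t)
  shift₂ = ℤ-Ring.solve-∀

-- A bounded list A ⊆ [m, M] is encoded by the offsets a - m; window i = m + 1 + j of the paper is window j here.
module WindowCounts {A : List ℤ} {m M : ℤ} (bounded : ∀ {a} → a ∈ A → m ℤ.≤ a × a ℤ.≤ M) (T : ℕ) where

  offset : ℤ → ℕ
  offset a = ∣ a - m ∣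

  n : ℕ
  n = T + ∣ M - m ∣

  windowCount : ℕ → ℕ
  windowCount j = count A T (m ℤ.+ + 1 ℤ.+ + j)

  private
    +offset : ∀ {a} → a ∈ A → + offset a ≡ a - m
    +offset a∈A = ℤ.0≤i⇒+∣i∣≡i (ℤ.i≤j⇒0≤j-i (proj₁ (bounded a∈A)))

    a≡m+offset : ∀ {a} → a ∈ A → a ≡ m ℤ.+ + offset a
    a≡m+offset {a} a∈A = trans (a≡m+[a-m] a m) (cong (λ i → m ℤ.+ i) (sym (+offset a∈A)))
      where
      a≡m+[a-m] : ∀ a m → a ≡ m ℤ.+ (a - m)
      a≡m+[a-m] = ℤ-Ring.solve-∀

    offset+T≤n : ∀ {a} → a ∈ A → offset a + T ≤ n
    offset+T≤n {a} a∈A = ≡.subst (offset a + T ≤_) (ℕ.+-comm _ T) (ℕ.+-monoˡ-≤ T offset≤∣M-m∣)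
      where
      m≤a = proj₁ (bounded a∈A)
      a≤M = proj₂ (bounded a∈A)
      +∣M-m∣ : + ∣ M - m ∣ ≡ M - m
      +∣M-m∣ = ℤ.0≤i⇒+∣i∣≡i (ℤ.i≤j⇒0≤j-i (ℤ.≤-trans m≤a a≤M))
      offset≤∣M-m∣ : offset a ≤ ∣ M - m ∣
      offset≤∣M-m∣ = ℤ.drop‿+≤+ (≡.subst₂ ℤ._≤_ (sym (+offset a∈A)) (sym +∣M-m∣) (ℤ.+-monoˡ-≤ (ℤ.- m) a≤M))

    offset-difference : ∀ {a b} → a ∈ A → b ∈ A → a - b ≡ offset a ⊖ offset b
    offset-difference {a} {b} a∈A b∈A = begin
      a - b                   ≡⟨ a-b≡[a-m]-[b-m] a b m ⟩
      (a - m) - (b - m)       ≡⟨ cong₂ _-_ (sym (+offset a∈A)) (sym (+offset b∈A)) ⟩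
      + offset a - + offset b ≡⟨ ℤ.m-n≡m⊖n (offset a) (offset b) ⟩
      offset a ⊖ offset b     ∎
      where
      a-b≡[a-m]-[b-m] : ∀ a b m → a - b ≡ (a - m) - (b - m)
      a-b≡[a-m]-[b-m] = ℤ-Ring.solve-∀

    windowCount≡∑𝟙 : ∀ j → windowCount j ≡ ∑[ a ∈ A ] 𝟙 (inWindow? T (offset a) j)
    windowCount≡∑𝟙 j = trans (length-filter≡∑𝟙 inInterval? A)
      (∑-cong A (λ {a} a∈A → 𝟙-cong (window⇔ {m} j T (a≡m+offset a∈A)) (inInterval? a) (inWindow? T (offset a) j)))
      where
      i = m ℤ.+ + 1 ℤ.+ + j
      inInterval? : ∀ a → Dec (i - + T ℤ.≤ a × a ℤ.< i)
      inInterval? a = i - + T ℤ.≤? a ×-dec a ℤ.<? i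

  ∑-windowCount : ∑[ j ∈ upTo n ] windowCount j ≡ length A * T
  ∑-windowCount = begin
    ∑[ j ∈ upTo n ] windowCount j                           ≡⟨ ∑-cong (upTo n) (λ {j} _ → windowCount≡∑𝟙 j) ⟩
    ∑[ j ∈ upTo n ] ∑[ a ∈ A ] 𝟙 (inWindow? T (offset a) j) ≡⟨ ∑-comm (upTo n) A _ ⟩
    ∑[ a ∈ A ] ∑[ j ∈ upTo n ] 𝟙 (inWindow? T (offset a) j) ≡⟨ ∑-cong A (λ a∈A → ∑-window {T} {n} (offset+T≤n a∈A)) ⟩
    ∑[ a ∈ A ] T                                            ≡⟨ ∑-const A T ⟩
    length A * T                                            ∎

  ∑-windowCount² : ∑[ j ∈ upTo n ] (windowCount j * windowCount j) ≡ ∑[ a ∈ A ] ∑[ b ∈ A ] (T ∸ ∣ a - b ∣)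
  ∑-windowCount² = begin
    ∑[ j ∈ upTo n ] (windowCount j * windowCount j)
      ≡⟨ ∑-cong (upTo n) (λ {j} _ → trans (cong₂ _*_ (windowCount≡∑𝟙 j) (windowCount≡∑𝟙 j)) (∑-*-∑ A A _ _)) ⟩
    ∑[ j ∈ upTo n ] ∑[ a ∈ A ] ∑[ b ∈ A ] (𝟙 (inWindow? T (offset a) j) * 𝟙 (inWindow? T (offset b) j))
      ≡⟨ ∑-comm (upTo n) A _ ⟩
    ∑[ a ∈ A ] ∑[ j ∈ upTo n ] ∑[ b ∈ A ] (𝟙 (inWindow? T (offset a) j) * 𝟙 (inWindow? T (offset b) j))
      ≡⟨ ∑-cong A (λ _ → ∑-comm (upTo n) A _) ⟩
    ∑[ a ∈ A ] ∑[ b ∈ A ] ∑[ j ∈ upTo n ] (𝟙 (inWindow? T (offset a) j) * 𝟙 (inWindow? T (offset b) j))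
      ≡⟨ ∑-cong A (λ a∈A → ∑-cong A (λ b∈A → ∑-window-overlap {T} {n} (offset+T≤n a∈A) (offset+T≤n b∈A))) ⟩
    ∑[ a ∈ A ] ∑[ b ∈ A ] (T ∸ ∣ offset a ⊖ offset b ∣)
      ≡⟨ ∑-cong A (λ a∈A → ∑-cong A (λ b∈A → cong (λ d → T ∸ ∣ d ∣) (sym (offset-difference a∈A b∈A)))) ⟩
    ∑[ a ∈ A ] ∑[ b ∈ A ] (T ∸ ∣ a - b ∣) ∎

foldr-⊓-≤ : ∀ x xs {a} → a ∈ x ∷ xs → foldr ℤ._⊓_ x xs ℤ.≤ a
foldr-⊓-≤ x []       (here refl)          = ℤ.≤-refl
foldr-⊓-≤ x (y ∷ ys) (here refl)          = ℤ.≤-trans (ℤ.i⊓j≤j y _) (foldr-⊓-≤ x ys (here refl))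
foldr-⊓-≤ x (y ∷ ys) (there (here refl))  = ℤ.i⊓j≤i y _
foldr-⊓-≤ x (y ∷ ys) (there (there a∈ys)) = ℤ.≤-trans (ℤ.i⊓j≤j y _) (foldr-⊓-≤ x ys (there a∈ys))

foldr-⊔-≥ : ∀ x xs {a} → a ∈ x ∷ xs → a ℤ.≤ foldr ℤ._⊔_ x xs
foldr-⊔-≥ x []       (here refl)          = ℤ.≤-refl
foldr-⊔-≥ x (y ∷ ys) (here refl)          = ℤ.≤-trans (foldr-⊔-≥ x ys (here refl)) (ℤ.i≤j⊔i y _)
foldr-⊔-≥ x (y ∷ ys) (there (here refl))  = ℤ.i≤i⊔j y _
foldr-⊔-≥ x (y ∷ ys) (there (there a∈ys)) = ℤ.≤-trans (foldr-⊔-≥ x ys (there a∈ys)) (ℤ.i≤j⊔i y _)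

-- Differences in a Sidon set

∈-diffs⇔ : ∀ {A : List ℤ} {s} → s ∈ diffs A ⇔ Any (λ a → Any (λ b → a - b ≡ s) A) A
∈-diffs⇔ {A} = mk⇔
  (λ s∈ → Any.map (Any.map sym ∘ Any.map⁻) (∈-concatMap⁻ (λ a → map (λ b → a - b) A) s∈))
  (λ p → ∈-concatMap⁺ (λ a → map (λ b → a - b) A) (Any.map (Any.map⁺ ∘ Any.map sym) p))

representations : List ℤ → ℤ → ℕ
representations A s = ∑[ a ∈ A ] ∑[ b ∈ A ] 𝟙 (a - b ℤ.≟ s)

module _ {A : List ℤ} (unique : Unique A) (sidon : IsSidon A) where

  representations-sidon : ∀ {s} → s ≢ + 0 → representations A s ≡ 𝟙 (s ∈? diffs A)
  representations-sidon {s} s≢0 = begin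
    ∑[ a ∈ A ] ∑[ b ∈ A ] 𝟙 (a - b ℤ.≟ s)
      ≡⟨ ∑-cong A (λ {a} _ → ∑-𝟙-atMostOne (λ b → a - b ℤ.≟ s) unique (λ _ _ → subtrahend-unique {a})) ⟩
    ∑[ a ∈ A ] 𝟙 (any? (λ b → a - b ℤ.≟ s) A)
      ≡⟨ ∑-𝟙-atMostOne (λ a → any? (λ b → a - b ℤ.≟ s) A) unique minuend-unique ⟩
    𝟙 (any? (λ a → any? (λ b → a - b ℤ.≟ s) A) A)
      ≡⟨ 𝟙-cong (⇔.sym (∈-diffs⇔ {A})) (any? (λ a → any? (λ b → a - b ℤ.≟ s) A) A) (s ∈? diffs A) ⟩
    𝟙 (s ∈? diffs A) ∎
    where
    subtrahend-unique : ∀ {a b b'} → a - b ≡ s → a - b' ≡ s → b ≡ b'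
    subtrahend-unique {a} {b} {b'} a-b≡s a-b'≡s = begin
      b            ≡⟨ sym (a-[a-b]≡b a b) ⟩
      a - (a - b)  ≡⟨ cong (a -_) (trans a-b≡s (sym a-b'≡s)) ⟩
      a - (a - b') ≡⟨ a-[a-b]≡b a b' ⟩
      b'           ∎
      where
      a-[a-b]≡b : ∀ a b → a - (a - b) ≡ b
      a-[a-b]≡b = ℤ-Ring.solve-∀

    minuend-unique : ∀ {a a'} → a ∈ A → a' ∈ A → Any (λ b → a - b ≡ s) A → Any (λ b → a' - b ≡ s) A → a ≡ a'
    minuend-unique {a} {a'} a∈A a'∈A p p' with find p | find p'
    ... | b , b∈A , a-b≡s | b' , b'∈A , a'-b'≡s with sidon a∈A b'∈A a'∈A b∈A a+b'≡a'+b
      where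
      a+b'≡a'+b : a ℤ.+ b' ≡ a' ℤ.+ b
      a+b'≡a'+b = begin
        a ℤ.+ b'                 ≡⟨ sym (shift a b b') ⟩
        (a - b) ℤ.+ (b ℤ.+ b')   ≡⟨ cong (ℤ._+ (b ℤ.+ b')) (trans a-b≡s (sym a'-b'≡s)) ⟩
        (a' - b') ℤ.+ (b ℤ.+ b') ≡⟨ trans (cong (λ i → (a' - b') ℤ.+ i) (ℤ.+-comm b b')) (shift a' b' b) ⟩
        a' ℤ.+ b                 ∎
        where
        shift : ∀ x y z → (x - y) ℤ.+ (y ℤ.+ z) ≡ x ℤ.+ z
        shift = ℤ-Ring.solve-∀
    ... | inj₁ (a≡a' , _) = a≡a'
    ... | inj₂ (a≡b  , _) = ⊥-elim (s≢0 (trans (sym a-b≡s) (ℤ.i≡j⇒i-j≡0 a≡b)))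

pairsAtDistance : List ℤ → ℕ → ℕ
pairsAtDistance A r = ∑[ a ∈ A ] ∑[ b ∈ A ] 𝟙 (∣ a - b ∣ ℕ.≟ r)

pairsAtDistance-zero : ∀ {A} → Unique A → pairsAtDistance A 0 ≡ length A
pairsAtDistance-zero {A} unique = begin
  ∑[ a ∈ A ] ∑[ b ∈ A ] 𝟙 (∣ a - b ∣ ℕ.≟ 0)
    ≡⟨ ∑-cong A (λ {a} a∈A → trans (∑-cong A (λ {b} _ → 𝟙-cong ∣a-b∣≡0⇔a≡b (∣ a - b ∣ ℕ.≟ 0) (a ℤ.≟ b)))
                                   (count-self a∈A)) ⟩
  ∑[ a ∈ A ] 1 ≡⟨ trans (∑-const A 1) (ℕ.*-identityʳ (length A)) ⟩
  length A     ∎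
  where
  ∣a-b∣≡0⇔a≡b : ∀ {a b} → ∣ a - b ∣ ≡ 0 ⇔ a ≡ b
  ∣a-b∣≡0⇔a≡b {a} {b} = mk⇔ (ℤ.i-j≡0⇒i≡j a b ∘ ℤ.∣i∣≡0⇒i≡0) (cong ∣_∣ ∘ ℤ.i≡j⇒i-j≡0)

  count-self : ∀ {a} → a ∈ A → ∑[ b ∈ A ] 𝟙 (a ℤ.≟ b) ≡ 1
  count-self {a} a∈A = trans (∑-𝟙-atMostOne (a ℤ.≟_) unique (λ _ _ a≡x a≡y → trans (sym a≡x) a≡y))
                             (𝟙-yes a∈A (any? (a ℤ.≟_) A))

𝟙-∣∣≟suc : ∀ i r → 𝟙 (∣ i ∣ ℕ.≟ suc r) ≡ 𝟙 (i ℤ.≟ +[1+ r ]) + 𝟙 (ℤ.- i ℤ.≟ +[1+ r ])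
𝟙-∣∣≟suc (+ zero) r = refl
𝟙-∣∣≟suc +[1+ n ] r = sym (ℕ.+-identityʳ _)
𝟙-∣∣≟suc -[1+ n ] r = refl

pairsAtDistance-suc : ∀ {A} → Unique A → IsSidon A → ∀ r →
                      pairsAtDistance A (suc r) ≡ 2 * 𝟙 (+[1+ r ] ∈? diffs A)
pairsAtDistance-suc {A} unique sidon r = begin
  ∑[ a ∈ A ] ∑[ b ∈ A ] 𝟙 (∣ a - b ∣ ℕ.≟ suc r)
    ≡⟨ ∑-cong A (λ {a} _ → ∑-cong A (λ {b} _ → trans (𝟙-∣∣≟suc (a - b) r)
                                                     (cong (λ i → 𝟙 (a - b ℤ.≟ s) + 𝟙 (i ℤ.≟ s)) (-[a-b]≡b-a a b)))) ⟩
  ∑[ a ∈ A ] ∑[ b ∈ A ] (𝟙 (a - b ℤ.≟ s) + 𝟙 (b - a ℤ.≟ s))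
    ≡⟨ ∑-cong A (λ {a} _ → ∑-distrib-+ A (λ b → 𝟙 (a - b ℤ.≟ s)) (λ b → 𝟙 (b - a ℤ.≟ s))) ⟩
  ∑[ a ∈ A ] (∑[ b ∈ A ] 𝟙 (a - b ℤ.≟ s) + ∑[ b ∈ A ] 𝟙 (b - a ℤ.≟ s))
    ≡⟨ ∑-distrib-+ A (λ a → ∑[ b ∈ A ] 𝟙 (a - b ℤ.≟ s)) (λ a → ∑[ b ∈ A ] 𝟙 (b - a ℤ.≟ s)) ⟩
  representations A s + ∑[ a ∈ A ] ∑[ b ∈ A ] 𝟙 (b - a ℤ.≟ s)
    ≡⟨ cong (λ n → representations A s + n) (∑-comm A A (λ a b → 𝟙 (b - a ℤ.≟ s))) ⟩
  representations A s + representations A s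
    ≡⟨ cong (λ n → representations A s + n) (sym (ℕ.+-identityʳ _)) ⟩
  2 * representations A s
    ≡⟨ cong (2 *_) (representations-sidon unique sidon (λ ())) ⟩
  2 * 𝟙 (s ∈? diffs A) ∎
  where
  s = +[1+ r ]
  -[a-b]≡b-a : ∀ a b → ℤ.- (a - b) ≡ b - a
  -[a-b]≡b-a = ℤ-Ring.solve-∀

∑∑-∸-distance : ∀ (A : List ℤ) T →
  ∑[ a ∈ A ] ∑[ b ∈ A ] (T ∸ ∣ a - b ∣) ≡ ∑[ r ∈ upTo T ] (pairsAtDistance A r * (T ∸ r))
∑∑-∸-distance A T = begin
  ∑[ a ∈ A ] ∑[ b ∈ A ] (T ∸ ∣ a - b ∣)
    ≡⟨ ∑-cong A (λ {a} _ → ∑-fibres T (T ∸_) (λ _ → ℕ.m≤n⇒m∸n≡0) A (λ b → ∣ a - b ∣)) ⟩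
  ∑[ a ∈ A ] ∑[ r ∈ upTo T ] (∑[ b ∈ A ] 𝟙 (∣ a - b ∣ ℕ.≟ r) * (T ∸ r))
    ≡⟨ ∑-comm A (upTo T) _ ⟩
  ∑[ r ∈ upTo T ] ∑[ a ∈ A ] (∑[ b ∈ A ] 𝟙 (∣ a - b ∣ ℕ.≟ r) * (T ∸ r))
    ≡⟨ ∑-cong (upTo T) (λ {r} _ → sym (*-distribʳ-∑ (T ∸ r) A _)) ⟩
  ∑[ r ∈ upTo T ] (pairsAtDistance A r * (T ∸ r)) ∎

gapWeight : List ℤ → ℕ → ℕ → ℕ
gapWeight A T zero    = 0
gapWeight A T (suc r) = if does (+[1+ r ] ∈? diffs A) then 0 else T ∸ suc r

module _ {A : List ℤ} (unique : Unique A) (sidon : IsSidon A) (t : ℕ) where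

  private
    T = suc t
    k = length A

    weight : ℕ → ℕ
    weight zero    = k
    weight (suc _) = 2

    𝟙-complement : ∀ {p} {P : Set p} (P? : Dec P) x → 2 * 𝟙 P? * x + 2 * (if does P? then 0 else x) ≡ 2 * x
    𝟙-complement P? x with does P?
    ... | true  = ℕ.+-identityʳ (2 * x)
    ... | false = refl

    pairs+gaps : ∀ r → pairsAtDistance A r * (T ∸ r) + 2 * gapWeight A T r ≡ weight r * (T ∸ r)
    pairs+gaps zero    = trans (ℕ.+-identityʳ _) (cong (_* T) (pairsAtDistance-zero unique))
    pairs+gaps (suc r) = trans (cong (λ n → n * (T ∸ suc r) + 2 * gapWeight A T (suc r)) (pairsAtDistance-suc unique sidon r))
                               (𝟙-complement (+[1+ r ] ∈? diffs A) (T ∸ suc r))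

  ∑∑-∸-distance+2∑gapWeight :
    ∑[ a ∈ A ] ∑[ b ∈ A ] (T ∸ ∣ a - b ∣) + 2 * ∑[ r ∈ upTo T ] gapWeight A T r ≡ T * (T + k ∸ 1)
  ∑∑-∸-distance+2∑gapWeight = begin
    ∑[ a ∈ A ] ∑[ b ∈ A ] (T ∸ ∣ a - b ∣) + 2 * ∑[ r ∈ upTo T ] gapWeight A T r
      ≡⟨ cong₂ _+_ (∑∑-∸-distance A T) (*-distribˡ-∑ 2 (upTo T) (gapWeight A T)) ⟩
    ∑[ r ∈ upTo T ] (pairsAtDistance A r * (T ∸ r)) + ∑[ r ∈ upTo T ] (2 * gapWeight A T r)
      ≡⟨ sym (∑-distrib-+ (upTo T) (λ r → pairsAtDistance A r * (T ∸ r)) (λ r → 2 * gapWeight A T r)) ⟩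
    ∑[ r ∈ upTo T ] (pairsAtDistance A r * (T ∸ r) + 2 * gapWeight A T r)
      ≡⟨ ∑-cong (upTo T) (λ {r} _ → pairs+gaps r) ⟩
    ∑[ r ∈ upTo T ] (weight r * (T ∸ r))
      ≡⟨ ∑-upTo-suc t (λ r → weight r * (T ∸ r)) ⟩
    k * T + ∑[ r ∈ upTo t ] (2 * (t ∸ r))
      ≡⟨ cong (λ n → k * T + n) (sym (*-distribˡ-∑ 2 (upTo t) (t ∸_))) ⟩
    k * T + 2 * ∑[ r ∈ upTo t ] (t ∸ r)
      ≡⟨ cong (λ n → k * T + n) (2*∑-upTo-∸ t) ⟩
    k * T + t * T
      ≡⟨ arithmetic k t ⟩
    T * (T + k ∸ 1) ∎
    where
    arithmetic : ∀ k t → k * suc t + t * suc t ≡ suc t * (t + k)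
    arithmetic = solve-∀

-- Rational arithmetic

ι : ℕ → ℚ
ι n = + n ℚ./ 1

private
  ι≡mkℚ : ∀ n → ι n ≡ mkℚ (+ n) 0 (Coprime.sym (Coprime.1-coprimeTo n))
  ι≡mkℚ n = ℚ.normalize-coprime (Coprime.sym (Coprime.1-coprimeTo n))

ι-+ : ∀ m n → ι (m + n) ≡ ι m ℚ.+ ι n
ι-+ m n = trans (ℚ./-cong {p₂ = + m ℤ.* + 1 ℤ.+ + n ℤ.* + 1} {q₂ = 1} numerators refl)
                (sym (cong₂ ℚ._+_ (ι≡mkℚ m) (ι≡mkℚ n)))
  where
  numerators : + (m + n) ≡ + m ℤ.* + 1 ℤ.+ + n ℤ.* + 1
  numerators = sym (cong₂ ℤ._+_ (ℤ.*-identityʳ (+ m)) (ℤ.*-identityʳ (+ n)))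

ι-* : ∀ m n → ι (m * n) ≡ ι m ℚ.* ι n
ι-* m n = trans (ℚ./-cong {p₂ = + m ℤ.* + n} {q₂ = 1} (ℤ.pos-* m n) refl) (sym (cong₂ ℚ._*_ (ι≡mkℚ m) (ι≡mkℚ n)))

/-*-cancel : ∀ p n → (p ℚ./ suc n) ℚ.* ι (suc n) ≡ p ℚ./ 1
/-*-cancel p n = ℚ.toℚᵘ-injective (ℚᵘ.≃-trans (ℚ.toℚᵘ-homo-* (p ℚ./ suc n) (ι (suc n)))
  (ℚᵘ.≃-trans (ℚᵘ.*-cong (ℚ.toℚᵘ-fromℚᵘ (ℚᵘ.mkℚᵘ p n)) (ℚ.toℚᵘ-fromℚᵘ (ℚᵘ.mkℚᵘ (+ suc n) 0)))
  (ℚᵘ.≃-trans (ℚᵘ.*≡* cross-multiplied) (ℚᵘ.≃-sym (ℚ.toℚᵘ-fromℚᵘ (ℚᵘ.mkℚᵘ p 0))))))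
  where
  cross-multiplied : (p ℤ.* + suc n) ℤ.* + 1 ≡ p ℤ.* + suc (n * 1)
  cross-multiplied = trans (ℤ.*-identityʳ _) (cong (λ d → p ℤ.* + suc d) (sym (ℕ.*-identityʳ n)))

÷-unique : ∀ p q r .{{_ : ℚ.NonZero q}} → r ℚ.* q ≡ p → p ℚ.÷ q ≡ r
÷-unique p q r r*q≡p = begin
  p ℚ.÷ q               ≡⟨ cong (ℚ._* ℚ.1/ q) (sym r*q≡p) ⟩
  r ℚ.* q ℚ.* ℚ.1/ q    ≡⟨ ℚ.*-assoc r q (ℚ.1/ q) ⟩
  r ℚ.* (q ℚ.* ℚ.1/ q)  ≡⟨ cong (r ℚ.*_) (ℚ.*-inverseʳ q) ⟩
  r ℚ.* ℚ.1ℚ           ≡⟨ ℚ.*-identityʳ r ⟩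
  r                     ∎

ℚ-ring : AlmostCommutativeRing 0ℓ 0ℓ
ℚ-ring = fromCommutativeRing ℚ.+-*-commutativeRing (λ q → dec⇒maybe (ℚ.0ℚ ℚ.≟ q))

module ℚ∑ = FiniteSum (CommutativeRing.commutativeSemiring ℚ.+-*-commutativeRing)

ι-∑ : ∀ {a} {A : Set a} (xs : List A) (f : A → ℕ) → ι (∑ xs f) ≡ ℚ∑.∑ xs (ι ∘ f)
ι-∑ []       f = refl
ι-∑ (x ∷ xs) f = trans (ι-+ (f x) (∑ xs f)) (cong (ι (f x) ℚ.+_) (ι-∑ xs f))

∑-squared-deviation : ∀ {a} {A : Set a} (xs : List A) (f : A → ℚ) μ →
  ℚ∑.∑ xs (λ x → (f x ℚ.- μ) ℚ.* (f x ℚ.- μ))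
    ≡ ℚ∑.∑ xs (λ x → f x ℚ.* f x) ℚ.- ι 2 ℚ.* μ ℚ.* ℚ∑.∑ xs f ℚ.+ ι (length xs) ℚ.* (μ ℚ.* μ)
∑-squared-deviation []       f μ = solve μ
  where
  solve : ∀ μ → ℚ.0ℚ ≡ ℚ.0ℚ ℚ.- ι 2 ℚ.* μ ℚ.* ℚ.0ℚ ℚ.+ ℚ.0ℚ ℚ.* (μ ℚ.* μ)
  solve = RingSolver.solve-∀ ℚ-ring
∑-squared-deviation (x ∷ xs) f μ = begin
  (f x ℚ.- μ) ℚ.* (f x ℚ.- μ) ℚ.+ ℚ∑.∑ xs (λ x → (f x ℚ.- μ) ℚ.* (f x ℚ.- μ))
    ≡⟨ cong ((f x ℚ.- μ) ℚ.* (f x ℚ.- μ) ℚ.+_) (∑-squared-deviation xs f μ) ⟩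
  (f x ℚ.- μ) ℚ.* (f x ℚ.- μ) ℚ.+ (S₂ ℚ.- ι 2 ℚ.* μ ℚ.* S₁ ℚ.+ ι (length xs) ℚ.* (μ ℚ.* μ))
    ≡⟨ expand (f x) μ S₁ S₂ (ι (length xs)) ⟩
  (f x ℚ.* f x ℚ.+ S₂) ℚ.- ι 2 ℚ.* μ ℚ.* (f x ℚ.+ S₁) ℚ.+ (ℚ.1ℚ ℚ.+ ι (length xs)) ℚ.* (μ ℚ.* μ)
    ≡⟨ cong (λ l → (f x ℚ.* f x ℚ.+ S₂) ℚ.- ι 2 ℚ.* μ ℚ.* (f x ℚ.+ S₁) ℚ.+ l ℚ.* (μ ℚ.* μ)) (sym (ι-+ 1 (length xs))) ⟩
  (f x ℚ.* f x ℚ.+ S₂) ℚ.- ι 2 ℚ.* μ ℚ.* (f x ℚ.+ S₁) ℚ.+ ι (suc (length xs)) ℚ.* (μ ℚ.* μ) ∎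
  where
  S₁ = ℚ∑.∑ xs f
  S₂ = ℚ∑.∑ xs (λ x → f x ℚ.* f x)
  expand : ∀ y μ S₁ S₂ l → (y ℚ.- μ) ℚ.* (y ℚ.- μ) ℚ.+ (S₂ ℚ.- ι 2 ℚ.* μ ℚ.* S₁ ℚ.+ l ℚ.* (μ ℚ.* μ))
             ≡ (y ℚ.* y ℚ.+ S₂) ℚ.- ι 2 ℚ.* μ ℚ.* (y ℚ.+ S₁) ℚ.+ (ℚ.1ℚ ℚ.+ l) ℚ.* (μ ℚ.* μ)
  expand = RingSolver.solve-∀ ℚ-ring

S≡ι∑gapWeight : ∀ A T → S A T ≡ ι (∑[ r ∈ upTo T ] gapWeight A T r)
S≡ι∑gapWeight A T = trans (ℚ∑.∑-cong (upTo T) (λ {r} r∈ → term≡ r (∈-upTo⁻ r∈))) (sym (ι-∑ (upTo T) (gapWeight A T)))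
  where
  term≡ : ∀ r → r < T →
    (if r ℕ.≡ᵇ 0 then ℚ.0ℚ else (if does (+ r ∈? diffs A) then ℚ.0ℚ else (+ T - + r) ℚ./ 1)) ≡ ι (gapWeight A T r)
  term≡ zero    _   = refl
  term≡ (suc r) r<T with does (+[1+ r ] ∈? diffs A)
  ... | true  = refl
  ... | false = cong (ℚ._/ 1) (trans (ℤ.m-n≡m⊖n T (suc r)) (ℤ.⊖-≥ (ℕ.<⇒≤ r<T)))

V-expansion : ∀ (A : List⁺ ℤ) T →
  let n = T + ∣ diam A ∣
      μ = (+ (length (toList A) * T)) /' n
      c = λ j → count (toList A) T (minA A ℤ.+ + 1 ℤ.+ + j)
  in V A T ≡ ι (∑[ j ∈ upTo n ] (c j * c j)) ℚ.- ι 2 ℚ.* μ ℚ.* ι (∑[ j ∈ upTo n ] c j) ℚ.+ ι n ℚ.* (μ ℚ.* μ)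
V-expansion A T = begin
  V A T
    ≡⟨ ∑-squared-deviation (upTo n) (ι ∘ c) μ ⟩
  F (ℚ∑.∑ (upTo n) (λ j → ι (c j) ℚ.* ι (c j))) (ℚ∑.∑ (upTo n) (ι ∘ c)) (length (upTo n))
    ≡⟨ cong₂ (λ q s → F q s (length (upTo n))) ∑-squares (sym (ι-∑ (upTo n) c)) ⟩
  F (ι (∑[ j ∈ upTo n ] (c j * c j))) (ι (∑[ j ∈ upTo n ] c j)) (length (upTo n))
    ≡⟨ cong (F (ι (∑[ j ∈ upTo n ] (c j * c j))) (ι (∑[ j ∈ upTo n ] c j))) (length-upTo n) ⟩
  F (ι (∑[ j ∈ upTo n ] (c j * c j))) (ι (∑[ j ∈ upTo n ] c j)) n ∎
  where
  n = T + ∣ diam A ∣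
  μ = (+ (length (toList A) * T)) /' n
  c = λ j → count (toList A) T (minA A ℤ.+ + 1 ℤ.+ + j)

  F : ℚ → ℚ → ℕ → ℚ
  F q s l = q ℚ.- ι 2 ℚ.* μ ℚ.* s ℚ.+ ι l ℚ.* (μ ℚ.* μ)

  ∑-squares : ℚ∑.∑ (upTo n) (λ j → ι (c j) ℚ.* ι (c j)) ≡ ι (∑[ j ∈ upTo n ] (c j * c j))
  ∑-squares = trans (ℚ∑.∑-cong (upTo n) (λ {j} _ → sym (ι-* (c j) (c j))))
                    (sym (ι-∑ (upTo n) (λ j → c j * c j)))

-- The diameter identity

module DiameterIdentity {x : ℤ} {xs : List ℤ} (unique : Unique (x ∷ xs)) (sidon : IsSidon (x ∷ xs)) (t : ℕ) where

  private
    A : List⁺ ℤ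
    A = x ∷ xs
    T = suc t
    k = length (toList A)

  open WindowCounts {toList A} {minA A} {maxA A} (λ a∈A → foldr-⊓-≤ x xs a∈A , foldr-⊔-≥ x xs a∈A) T
    using (n; windowCount; ∑-windowCount; ∑-windowCount²)

  mean : ℚ
  mean = (+ (k * T)) /' n

  D : ℚ
  D = ι (T * (T + k ∸ 1)) ℚ.- (ι 2 ℚ.* S (toList A) T ℚ.+ V A T)

  private
    Q = ∑[ j ∈ upTo n ] (windowCount j * windowCount j)
    G = ∑[ r ∈ upTo T ] gapWeight (toList A) T r

  mean*n≡kT : mean ℚ.* ι n ≡ ι (k * T)
  mean*n≡kT = /-*-cancel (+ (k * T)) (t + ∣ diam A ∣)

  V≡Q-n*mean² : V A T ≡ ι Q ℚ.- ι n ℚ.* (mean ℚ.* mean)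
  V≡Q-n*mean² = begin
    V A T
      ≡⟨ V-expansion A T ⟩
    ι Q ℚ.- ι 2 ℚ.* mean ℚ.* ι (∑[ j ∈ upTo n ] windowCount j) ℚ.+ ι n ℚ.* (mean ℚ.* mean)
      ≡⟨ cong (λ s → ι Q ℚ.- ι 2 ℚ.* mean ℚ.* s ℚ.+ ι n ℚ.* (mean ℚ.* mean)) (trans (cong ι ∑-windowCount) (sym mean*n≡kT)) ⟩
    ι Q ℚ.- ι 2 ℚ.* mean ℚ.* (mean ℚ.* ι n) ℚ.+ ι n ℚ.* (mean ℚ.* mean)
      ≡⟨ simplify (ι Q) mean (ι n) ⟩
    ι Q ℚ.- ι n ℚ.* (mean ℚ.* mean) ∎
    where
    simplify : ∀ q μ n → q ℚ.- ι 2 ℚ.* μ ℚ.* (μ ℚ.* n) ℚ.+ n ℚ.* (μ ℚ.* μ) ≡ q ℚ.- n ℚ.* (μ ℚ.* μ)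
    simplify = RingSolver.solve-∀ ℚ-ring

  T[T+k∸1]≡Q+2G : T * (T + k ∸ 1) ≡ Q + 2 * G
  T[T+k∸1]≡Q+2G = sym (trans (cong (λ q → q + 2 * G) ∑-windowCount²) (∑∑-∸-distance+2∑gapWeight unique sidon t))

  D≡n*mean² : D ≡ ι n ℚ.* (mean ℚ.* mean)
  D≡n*mean² = begin
    ι (T * (T + k ∸ 1)) ℚ.- (ι 2 ℚ.* S (toList A) T ℚ.+ V A T)
      ≡⟨ cong₂ (λ a b → a ℚ.- (ι 2 ℚ.* b ℚ.+ V A T)) ι[Q+2G] (S≡ι∑gapWeight (toList A) T) ⟩
    (ι Q ℚ.+ ι 2 ℚ.* ι G) ℚ.- (ι 2 ℚ.* ι G ℚ.+ V A T)
      ≡⟨ cong (λ v → (ι Q ℚ.+ ι 2 ℚ.* ι G) ℚ.- (ι 2 ℚ.* ι G ℚ.+ v)) V≡Q-n*mean² ⟩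
    (ι Q ℚ.+ ι 2 ℚ.* ι G) ℚ.- (ι 2 ℚ.* ι G ℚ.+ (ι Q ℚ.- ι n ℚ.* (mean ℚ.* mean)))
      ≡⟨ simplify (ι Q) (ι 2 ℚ.* ι G) (ι n ℚ.* (mean ℚ.* mean)) ⟩
    ι n ℚ.* (mean ℚ.* mean) ∎
    where
    ι[Q+2G] : ι (T * (T + k ∸ 1)) ≡ ι Q ℚ.+ ι 2 ℚ.* ι G
    ι[Q+2G] = trans (cong ι T[T+k∸1]≡Q+2G) (trans (ι-+ Q (2 * G)) (cong (ι Q ℚ.+_) (ι-* 2 G)))
    simplify : ∀ q g v → (q ℚ.+ g) ℚ.- (g ℚ.+ (q ℚ.- v)) ≡ v
    simplify = RingSolver.solve-∀ ℚ-ring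

  instance
    mean-pos : ℚ.Positive mean
    mean-pos = ℚ.normalize-pos (k * T) n

    n-pos : ℚ.Positive (ι n)
    n-pos = ℚ.normalize-pos n 1

    mean²-pos : ℚ.Positive (mean ℚ.* mean)
    mean²-pos = ℚ.pos*pos⇒pos mean mean

  D≢0 : ℚ.NonZero D
  D≢0 = ≡.subst ℚ.NonZero (sym D≡n*mean²)
    (ℚ.pos⇒nonZero (ι n ℚ.* (mean ℚ.* mean)) {{ℚ.pos*pos⇒pos (ι n) (mean ℚ.* mean)}})

  k²T²÷D≡n : ℚ._÷_ (ι (k * k * (T * T))) D {{D≢0}} ≡ ι n
  k²T²÷D≡n = ÷-unique (ι (k * k * (T * T))) D (ι n) {{D≢0}} (begin
    ι n ℚ.* D                                 ≡⟨ cong (ι n ℚ.*_) D≡n*mean² ⟩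
    ι n ℚ.* (ι n ℚ.* (mean ℚ.* mean))         ≡⟨ regroup mean (ι n) ⟩
    (mean ℚ.* ι n) ℚ.* (mean ℚ.* ι n)         ≡⟨ cong₂ ℚ._*_ mean*n≡kT mean*n≡kT ⟩
    ι (k * T) ℚ.* ι (k * T)                   ≡⟨ sym (ι-* (k * T) (k * T)) ⟩
    ι (k * T * (k * T))                       ≡⟨ cong ι (square k T) ⟩
    ι (k * k * (T * T))                       ∎)
    where
    regroup : ∀ μ n → n ℚ.* (n ℚ.* (μ ℚ.* μ)) ≡ (μ ℚ.* n) ℚ.* (μ ℚ.* n)
    regroup = RingSolver.solve-∀ ℚ-ring
    square : ∀ k T → k * T * (k * T) ≡ k * k * (T * T)
    square = solve-∀

  diam≡n-T : diam A ℚ./ 1 ≡ ι n ℚ.- ι T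
  diam≡n-T = begin
    diam A ℚ./ 1                       ≡⟨ cong (ℚ._/ 1) (sym +∣diam∣) ⟩
    ι ∣ diam A ∣                       ≡⟨ d≡[T+d]-T (ι T) (ι ∣ diam A ∣) ⟩
    (ι T ℚ.+ ι ∣ diam A ∣) ℚ.- ι T     ≡⟨ cong (ℚ._- ι T) (sym (ι-+ T ∣ diam A ∣)) ⟩
    ι n ℚ.- ι T                        ∎
    where
    +∣diam∣ : + ∣ diam A ∣ ≡ diam A
    +∣diam∣ = ℤ.0≤i⇒+∣i∣≡i (ℤ.i≤j⇒0≤j-i (ℤ.≤-trans (foldr-⊓-≤ x xs (here refl)) (foldr-⊔-≥ x xs (here refl))))
    d≡[T+d]-T : ∀ a b → b ≡ (a ℚ.+ b) ℚ.- a
    d≡[T+d]-T = RingSolver.solve-∀ ℚ-ring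

theorem4 : (A : List⁺ ℤ) → Unique (toList A) → IsSidon (toList A) →
    (T : ℕ) → 1 ℕ.≤ T →
    let k = length (toList A)
        D = ℚ._-_ (ℚ._/_ (+ (T ℕ.* (T ℕ.+ k ℕ.∸ 1))) 1) (ℚ._+_ (ℚ._*_ (ℚ._/_ (+ 2) 1) (S (toList A) T)) (V A T))
    in Σ[ nz ∈ ℚ.NonZero D ]
       (ℚ._/_ (diam A) 1 ≡ ℚ._-_ (ℚ._÷_ (ℚ._/_ (+ (k ℕ.* k ℕ.* (T ℕ.* T))) 1) D {{nz}}) (ℚ._/_ (+ T) 1))
theorem4 (x ∷ xs) unique sidon (suc t) _ = D≢0 , trans diam≡n-T (cong (ℚ._- ι (suc t)) (sym k²T²÷D≡n))
  where open DiameterIdentity unique sidon t
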